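{- For every positive integer $k$, $m(k,2)=2k$ and $m(k,3)=3k$.
   Context: All graphs are finite and simple; $N(v)$ denotes the set of neighbours of a vertex $v$. For a positive integer $k$, a $k$-dominating independent set ($k$-DIS) of a graph $G$ is an independent set $D\subseteq V(G)$ such that every vertex $v\in V(G)\setminus D$ satisfies $|N(v)\cap D|\ge k$. For positive integers $k,t$, $m(k,t)$ denotes the smallest integer $n$ such that there exists a graph on $n$ vertices containing at least $t$ $k$-DISes. -}

module Defs where

open import Data.Nat using (ℕ; _≤_; _<_)
open import Data.Bool using (Bool; true; false)
open import Data.Fin using (Fin)
open import Data.Fin.Subset using (Subset; _∈_; _∉_; _∩_; ∣_∣)
open import Data.Vec using (tabulate)
open import Data.Product using (Σ; _×_)
open import Function.Definitions using (Injective)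
open import Relation.Binary.PropositionalEquality using (_≡_)
open import Relation.Nullary using (¬_)

record Graph (n : ℕ) : Set where
  field
    adj   : Fin n → Fin n → Bool
    sym   : ∀ u v → adj u v ≡ adj v u
    irrefl : ∀ v → adj v v ≡ false

open Graph public

N : ∀ {n} → Graph n → Fin n → Subset n
N G v = tabulate (adj G v)

Independent : ∀ {n} → Graph n → Subset n → Set
Independent G D = ∀ u v → u ∈ D → v ∈ D → adj G u v ≡ false

IsKDIS : ∀ {n} → ℕ → Graph n → Subset n → Set
IsKDIS k G D = Independent G D × (∀ v → v ∉ D → k ≤ ∣ N G v ∩ D ∣)

HasAtLeastKDIS : ∀ {n} → ℕ → ℕ → Graph n → Set
HasAtLeastKDIS {n} k t G =
  Σ (Fin t → Subset n) λ f → Injective _≡_ _≡_ f × (∀ i → IsKDIS k G (f i))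

Realisable : ℕ → ℕ → ℕ → Set
Realisable k t n = Σ (Graph n) λ G → HasAtLeastKDIS k t G

-- m(k,t) = M : M is the smallest n for which Realisable k t n holds.
IsM : ℕ → ℕ → ℕ → Set
IsM k t M = Realisable k t M × (∀ n → n < M → ¬ Realisable k t n)

module Submission where

-- In the complete t-partite graph with t parts of size k
-- (vertex set Fin (t * k), parts given by `quotient k`) each part is an
-- independent set, and every vertex outside a part is adjacent to all k of
-- its vertices; so the t parts are t distinct k-DISes on t·k vertices.
--
-- If D, D' are k-DISes and some x ∈ D' lies outside D, then
-- x has at least k neighbours in D, none of which lies in the independent
-- set D'; hence |D ∖ D'| ≥ k.  For k ≥ 1 this forces |D ∖ D'| ≥ k for ANY
-- two distinct k-DISes.  Given k-DISes D₀, D₁ (resp. D₀, D₁, D₂), the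
-- "cyclic" differences D₀∖D₁, D₁∖D₀ (resp. D₀∖D₁, D₁∖D₂, D₂∖D₀) are
-- pairwise disjoint, so the graph has at least 2k (resp. 3k) vertices.

open import Defs
open import Data.Nat using (ℕ; _≤_; _*_)
open import Data.Product using (_×_)

open import Data.Nat using (zero; suc; _+_; z≤n; s≤s)
open import Data.Nat.Properties
  using (≤-trans; <-≤-trans; <⇒≱; +-suc; +-mono-≤; +-identityʳ; +-assoc; module ≤-Reasoning)
open import Data.Bool using (Bool; true; false; not)
open import Data.Fin using (Fin; quotient; combine; _≟_) renaming (suc to sucF)
open import Data.Fin.Patterns using (0F; 1F; 2F)
open import Data.Fin.Properties using (suc-injective; remQuot-combine; combine-injectiveʳ)
open import Data.Fin.Subset using (Subset; _∈_; _∉_; _⊆_; _∩_; _∪_; ∁; ∣_∣; _-_; Nonempty; Empty)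
open import Data.Fin.Subset.Properties
open import Data.Vec using ([]; _∷_; tabulate; here; there)
open import Data.Vec.Properties using (lookup∘tabulate; []=⇒lookup; lookup⇒[]=)
open import Data.Product using (_,_; proj₁; proj₂)
open import Data.Sum using (inj₁; inj₂)
open import Function.Bundles using (mk⇔)
open import Function.Definitions using (Injective)
open import Relation.Nullary using (Dec; does; yes; no; contradiction)
open import Relation.Nullary.Decidable using (dec-true; dec-false; does-⇔)
open import Relation.Binary.PropositionalEquality
  using (_≡_; _≢_; refl; trans; cong; subst) renaming (sym to ≡-sym)

∣p∪q∣≡∣p∣+∣q∣ : ∀ {n} (p q : Subset n) → Empty (p ∩ q) → ∣ p ∪ q ∣ ≡ ∣ p ∣ + ∣ q ∣
∣p∪q∣≡∣p∣+∣q∣ []          []          _     = refl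
∣p∪q∣≡∣p∣+∣q∣ (true ∷ p)  (true ∷ q)  p∩q=∅ = contradiction (0F , here) p∩q=∅
∣p∪q∣≡∣p∣+∣q∣ (true ∷ p)  (false ∷ q) p∩q=∅ =
  cong suc (∣p∪q∣≡∣p∣+∣q∣ p q (drop-∷-Empty p∩q=∅))
∣p∪q∣≡∣p∣+∣q∣ (false ∷ p) (true ∷ q)  p∩q=∅ =
  trans (cong suc (∣p∪q∣≡∣p∣+∣q∣ p q (drop-∷-Empty p∩q=∅))) (≡-sym (+-suc ∣ p ∣ ∣ q ∣))
∣p∪q∣≡∣p∣+∣q∣ (false ∷ p) (false ∷ q) p∩q=∅ = ∣p∪q∣≡∣p∣+∣q∣ p q (drop-∷-Empty p∩q=∅)

injection⇒m≤∣p∣ : ∀ {m n} {p : Subset n} (ι : Fin m → Fin n) →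
                  Injective _≡_ _≡_ ι → (∀ i → ι i ∈ p) → m ≤ ∣ p ∣
injection⇒m≤∣p∣ {zero}  ι _       _   = z≤n
injection⇒m≤∣p∣ {suc m} {p = p} ι ι-injective ι∈p =
  <-≤-trans (s≤s (injection⇒m≤∣p∣ (λ i → ι (sucF i)) (λ e → suc-injective (ι-injective e)) ι∈p-ι0))
            (x∈p⇒∣p-x∣<∣p∣ (ι∈p 0F))
  where
  ι∈p-ι0 : ∀ i → ι (sucF i) ∈ p - ι 0F
  ι∈p-ι0 i = x∈p∧x≢y⇒x∈p-y (ι∈p (sucF i)) (λ e → contradiction (ι-injective e) λ ())

0<∣p∣⇒Nonempty : ∀ {n} (p : Subset n) → 1 ≤ ∣ p ∣ → Nonempty p
0<∣p∣⇒Nonempty {n} p 1≤∣p∣ with nonempty? p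
... | yes p≠∅ = p≠∅
... | no  p=∅ = contradiction (subst (1 ≤_) ∣p∣≡0 1≤∣p∣) λ ()
  where
  ∣p∣≡0 : ∣ p ∣ ≡ 0
  ∣p∣≡0 = trans (cong ∣_∣ (Empty-unique p=∅)) (∣⊥∣≡0 n)

∈-tabulate⁺ : ∀ {n} (f : Fin n → Bool) {x} → f x ≡ true → x ∈ tabulate f
∈-tabulate⁺ f {x} fx≡true = lookup⇒[]= x (tabulate f) (trans (lookup∘tabulate f x) fx≡true)

∈-tabulate⁻ : ∀ {n} (f : Fin n → Bool) {x} → x ∈ tabulate f → f x ≡ true
∈-tabulate⁻ f {x} x∈ = trans (≡-sym (lookup∘tabulate f x)) ([]=⇒lookup x∈)

does≡true⇒ : ∀ {A : Set} (a? : Dec A) → does a? ≡ true → A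
does≡true⇒ (yes a) _ = a

module CompleteMultipartite (t k : ℕ) where

  -- Vertex v lies in part `part v`; part j consists of the vertices combine j i.
  part : Fin (t * k) → Fin t
  part = quotient k

  samePart : Fin (t * k) → Fin (t * k) → Bool
  samePart u v = does (part u ≟ part v)

  G : Graph (t * k)
  G = record
    { adj    = λ u v → not (samePart u v)
    ; sym    = λ u v → cong not (does-⇔ (mk⇔ ≡-sym ≡-sym) (part u ≟ part v) (part v ≟ part u))
    ; irrefl = λ v → cong not (dec-true (part v ≟ part v) refl)
    }

  class : Fin t → Subset (t * k)
  class j = tabulate λ v → does (part v ≟ j)

  ∈class⁺ : ∀ {j v} → part v ≡ j → v ∈ class j
  ∈class⁺ {j} {v} pv≡j = ∈-tabulate⁺ _ (dec-true (part v ≟ j) pv≡j)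

  ∈class⁻ : ∀ {j v} → v ∈ class j → part v ≡ j
  ∈class⁻ {j} {v} v∈ = does≡true⇒ (part v ≟ j) (∈-tabulate⁻ _ v∈)

  k≤∣class∣ : ∀ j → k ≤ ∣ class j ∣
  k≤∣class∣ j = injection⇒m≤∣p∣ (combine j) (combine-injectiveʳ j _ j _)
                  (λ i → ∈class⁺ (cong proj₁ (remQuot-combine j i)))

  class⊆N : ∀ {j v} → v ∉ class j → class j ⊆ N G v
  class⊆N {j} {v} v∉ {w} w∈ = ∈-tabulate⁺ _ (cong not (dec-false (part v ≟ part w) pv≢pw))
    where
    pv≢pw : part v ≢ part w
    pv≢pw pv≡pw = v∉ (∈class⁺ (trans pv≡pw (∈class⁻ w∈)))

  class-isKDIS : ∀ j → IsKDIS k G (class j)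
  class-isKDIS j = independent , dominating
    where
    independent : Independent G (class j)
    independent u v u∈ v∈ =
      cong not (dec-true (part u ≟ part v) (trans (∈class⁻ u∈) (≡-sym (∈class⁻ v∈))))
    dominating : ∀ v → v ∉ class j → k ≤ ∣ N G v ∩ class j ∣
    dominating v v∉ = ≤-trans (k≤∣class∣ j)
      (p⊆q⇒∣p∣≤∣q∣ (λ w∈ → x∈p∩q⁺ (class⊆N v∉ w∈ , w∈)))

  -- For k ≥ 1 the parts are nonempty, hence pairwise distinct.
  class-injective : 1 ≤ k → Injective _≡_ _≡_ class
  class-injective 1≤k {i} {j} classi≡classj with 0<∣p∣⇒Nonempty (class i) (≤-trans 1≤k (k≤∣class∣ i))
  ... | v , v∈i = trans (≡-sym (∈class⁻ v∈i)) (∈class⁻ (subst (v ∈_) classi≡classj v∈i))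

  realisable : 1 ≤ k → Realisable k t (t * k)
  realisable 1≤k = G , class , class-injective 1≤k , class-isKDIS

module _ {n k : ℕ} {G : Graph n} where

  -- A vertex x ∈ D' ∖ D has ≥ k neighbours in D; none of them lies in the
  -- independent set D', so all of them lie in D ∖ D'.
  kdis-gap : ∀ {D D'} → IsKDIS k G D → IsKDIS k G D' →
             Nonempty (D' ∩ ∁ D) → k ≤ ∣ D ∩ ∁ D' ∣
  kdis-gap {D} {D'} (_ , D-dominating) (D'-independent , _) (x , x∈D'∖D) =
    ≤-trans (D-dominating x x∉D) (p⊆q⇒∣p∣≤∣q∣ N[x]∩D⊆D∖D')
    where
    x∈D' = proj₁ (x∈p∩q⁻ D' (∁ D) x∈D'∖D)
    x∉D  = x∈∁p⇒x∉p (proj₂ (x∈p∩q⁻ D' (∁ D) x∈D'∖D))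
    N[x]∩D⊆D∖D' : N G x ∩ D ⊆ D ∩ ∁ D'
    N[x]∩D⊆D∖D' {y} y∈ with x∈p∩q⁻ (N G x) D y∈
    ... | y∈N[x] , y∈D = x∈p∩q⁺ (y∈D , x∉p⇒x∈∁p y∉D')
      where
      y∉D' : y ∉ D'
      y∉D' y∈D' = contradiction (trans (≡-sym (∈-tabulate⁻ (adj G x) y∈N[x]))
                                       (D'-independent x y x∈D' y∈D')) λ ()

  ∖-Empty⇒⊆ : ∀ {D D' : Subset n} → Empty (D ∩ ∁ D') → D ⊆ D'
  ∖-Empty⇒⊆ D∖D'=∅ x∈D = x∉∁p⇒x∈p λ x∈∁D' → D∖D'=∅ (_ , x∈p∩q⁺ (x∈D , x∈∁D'))

  -- For k ≥ 1, two distinct k-DISes each have ≥ k vertices outside the other: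
  -- one of the differences is nonempty, and kdis-gap bounds the other one
  -- (and hence makes it nonempty too).
  distinct-kdis-gap : 1 ≤ k → ∀ {D D'} → IsKDIS k G D → IsKDIS k G D' →
                      D ≢ D' → k ≤ ∣ D ∩ ∁ D' ∣
  distinct-kdis-gap 1≤k {D} {D'} kD kD' D≢D' with nonempty? (D' ∩ ∁ D) | nonempty? (D ∩ ∁ D')
  ... | yes D'∖D≠∅ | _          = kdis-gap kD kD' D'∖D≠∅
  ... | no  D'∖D=∅ | yes D∖D'≠∅ =
    contradiction (0<∣p∣⇒Nonempty _ (≤-trans 1≤k (kdis-gap kD' kD D∖D'≠∅))) D'∖D=∅
  ... | no  D'∖D=∅ | no  D∖D'=∅ =
    contradiction (⊆-antisym (∖-Empty⇒⊆ D∖D'=∅) (∖-Empty⇒⊆ D'∖D=∅)) D≢D'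

consecutive-∖-disjoint : ∀ {n} (a b c : Subset n) → Empty ((a ∩ ∁ b) ∩ (b ∩ ∁ c))
consecutive-∖-disjoint a b c (x , x∈) with x∈p∩q⁻ (a ∩ ∁ b) (b ∩ ∁ c) x∈
... | x∈a∖b , x∈b∖c =
  x∈∁p⇒x∉p (proj₂ (x∈p∩q⁻ a (∁ b) x∈a∖b)) (proj₁ (x∈p∩q⁻ b (∁ c) x∈b∖c))

∪-Empty-∩ : ∀ {n} (p q r : Subset n) → Empty (p ∩ r) → Empty (q ∩ r) → Empty ((p ∪ q) ∩ r)
∪-Empty-∩ p q r p∩r=∅ q∩r=∅ (x , x∈) with x∈p∩q⁻ (p ∪ q) r x∈
... | x∈p∪q , x∈r with x∈p∪q⁻ p q x∈p∪q
...   | inj₁ x∈p = p∩r=∅ (x , x∈p∩q⁺ (x∈p , x∈r))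
...   | inj₂ x∈q = q∩r=∅ (x , x∈p∩q⁺ (x∈q , x∈r))

module Realisation {k t n : ℕ} (1≤k : 1 ≤ k) (R : Realisable k t n) where

  G : Graph n
  G = proj₁ R

  D : Fin t → Subset n
  D = proj₁ (proj₂ R)

  D-injective : Injective _≡_ _≡_ D
  D-injective = proj₁ (proj₂ (proj₂ R))

  D-isKDIS : ∀ i → IsKDIS k G (D i)
  D-isKDIS = proj₂ (proj₂ (proj₂ R))

  gap : ∀ i j → i ≢ j → k ≤ ∣ D i ∩ ∁ (D j) ∣
  gap i j i≢j = distinct-kdis-gap {G = G} 1≤k (D-isKDIS i) (D-isKDIS j) (λ Di≡Dj → i≢j (D-injective Di≡Dj))

-- Two distinct k-DISes need 2k vertices: D₀ ∖ D₁ and D₁ ∖ D₀ are disjoint.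
lower-bound-2 : ∀ {k n} → 1 ≤ k → Realisable k 2 n → 2 * k ≤ n
lower-bound-2 {k} {n} 1≤k real = begin
  2 * k          ≡⟨ cong (k +_) (+-identityʳ k) ⟩
  k + k          ≤⟨ +-mono-≤ (gap 0F 1F λ ()) (gap 1F 0F λ ()) ⟩
  ∣ P ∣ + ∣ Q ∣  ≡⟨ ∣p∪q∣≡∣p∣+∣q∣ P Q (consecutive-∖-disjoint (D 0F) (D 1F) (D 0F)) ⟨
  ∣ P ∪ Q ∣      ≤⟨ ∣p∣≤n (P ∪ Q) ⟩
  n              ∎
  where
  open Realisation 1≤k real
  open ≤-Reasoning
  P Q : Subset n
  P = D 0F ∩ ∁ (D 1F)
  Q = D 1F ∩ ∁ (D 0F)

-- Three distinct k-DISes need 3k vertices: the cyclic differences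
-- D₀ ∖ D₁, D₁ ∖ D₂, D₂ ∖ D₀ are pairwise disjoint.
lower-bound-3 : ∀ {k n} → 1 ≤ k → Realisable k 3 n → 3 * k ≤ n
lower-bound-3 {k} {n} 1≤k real = begin
  3 * k                  ≡⟨ cong (λ z → k + (k + z)) (+-identityʳ k) ⟩
  k + (k + k)            ≡⟨ +-assoc k k k ⟨
  k + k + k              ≤⟨ +-mono-≤ (+-mono-≤ (gap 0F 1F λ ()) (gap 1F 2F λ ())) (gap 2F 0F λ ()) ⟩
  ∣ P ∣ + ∣ Q ∣ + ∣ R ∣  ≡⟨ cong (_+ ∣ R ∣) (∣p∪q∣≡∣p∣+∣q∣ P Q P∩Q=∅) ⟨
  ∣ P ∪ Q ∣ + ∣ R ∣      ≡⟨ ∣p∪q∣≡∣p∣+∣q∣ (P ∪ Q) R (∪-Empty-∩ P Q R P∩R=∅ Q∩R=∅) ⟨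
  ∣ (P ∪ Q) ∪ R ∣        ≤⟨ ∣p∣≤n ((P ∪ Q) ∪ R) ⟩
  n                      ∎
  where
  open Realisation 1≤k real
  open ≤-Reasoning
  P Q R : Subset n
  P = D 0F ∩ ∁ (D 1F)
  Q = D 1F ∩ ∁ (D 2F)
  R = D 2F ∩ ∁ (D 0F)
  P∩Q=∅ : Empty (P ∩ Q)
  P∩Q=∅ = consecutive-∖-disjoint (D 0F) (D 1F) (D 2F)
  Q∩R=∅ : Empty (Q ∩ R)
  Q∩R=∅ = consecutive-∖-disjoint (D 1F) (D 2F) (D 0F)
  P∩R=∅ : Empty (P ∩ R)
  P∩R=∅ = subst Empty (∩-comm R P) (consecutive-∖-disjoint (D 2F) (D 0F) (D 1F))

isM : ∀ {k t M} → Realisable k t M → (∀ {n} → Realisable k t n → M ≤ n) → IsM k t M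
isM realM lower = realM , λ n n<M realn → <⇒≱ n<M (lower realn)

proposition2p2 : ∀ (k : ℕ) → 1 ≤ k → IsM k 2 (2 * k) × IsM k 3 (3 * k)
proposition2p2 k 1≤k =
    isM (CompleteMultipartite.realisable 2 k 1≤k) (lower-bound-2 1≤k)
  , isM (CompleteMultipartite.realisable 3 k 1≤k) (lower-bound-3 1≤k)
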